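{- Let $m\ge 2$ and let $P(x_1,\ldots,x_m)$ be a polynomial with integer coefficients such that no algorithm exists for deciding, for an arbitrary positive integer $a$, whether $P(a,x_2,\ldots,x_m)=0$ has a solution in nonnegative integers $x_2,\ldots,x_m$. Define \[Q(x_1,\ldots,x_{m+1})=e\cdot C_{m+1}\big(x_1,\ldots,x_m,P(x_1,\ldots,x_m)^2\,x_{m+1}\big),\] where $e$ is a positive integer chosen such that $Q$ has integer coefficients. Let $a$ be a positive integer. Then the equation $P(a,x_2,\ldots,x_m)=0$ has a solution in nonnegative integers if and only if there exist nonnegative integers $b_2,\ldots,b_{m+1},c_2,\ldots,c_{m+1}$ such that $Q(a,b_2,\ldots,b_{m+1})=Q(a,c_2,\ldots,c_{m+1})$ and $(b_2,\ldots,b_{m+1})\neq(c_2,\ldots,c_{m+1})$.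
   Context: The Cantor polynomials are defined by $C_2(x_1,x_2)=\tfrac12(x_1+x_2)(x_1+x_2+1)+x_2$ and $C_{k+1}(x_1,\ldots,x_{k+1})=C_2(C_k(x_1,\ldots,x_k),x_{k+1})$ for $k\ge 2$; each $C_k$ is injective on $\mathbb{N}^k$, where $\mathbb{N}$ is the set of nonnegative integers. -}

module Defs where

open import Data.Nat using (ℕ; zero; suc; _+_; _*_; _/_; _≤_)
open import Data.Integer as ℤ using (ℤ; +_; ∣_∣)
open import Data.Fin using (Fin)
open import Data.Vec using (Vec; []; _∷_; _∷ʳ_; lookup; map)
open import Data.Bool using (Bool; true)
open import Data.Product using (Σ; ∃-syntax; _×_; _,_)
open import Relation.Binary.PropositionalEquality using (_≡_)
open import Relation.Nullary using (¬_)
open import Function.Bundles using (_⇔_)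

data Poly (n : ℕ) : Set where
  const : ℤ → Poly n
  var   : Fin n → Poly n
  _⊕_   : Poly n → Poly n → Poly n
  _⊗_   : Poly n → Poly n → Poly n

eval : {n : ℕ} → Poly n → Vec ℤ n → ℤ
eval (const c) v = c
eval (var i)   v = lookup v i
eval (p ⊕ q)   v = eval p v ℤ.+ eval q v
eval (p ⊗ q)   v = eval p v ℤ.* eval q v

-- Cantor pairing polynomial C₂(x,y) = ½(x+y)(x+y+1) + y  (exact division).
C₂ : ℕ → ℕ → ℕ
C₂ x y = ((x + y) * (x + y + 1)) / 2 + y

cantorFrom : {j : ℕ} → ℕ → Vec ℕ j → ℕ
cantorFrom c []       = c
cantorFrom c (y ∷ ys) = cantorFrom (C₂ c y) ys

-- C_k for k = j + 2 ≥ 2:  C_{k+1}(x₁,…,x_{k+1}) = C₂(C_k(x₁,…,x_k), x_{k+1}).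
Cantor : {j : ℕ} → Vec ℕ (suc (suc j)) → ℕ
Cantor (x₁ ∷ x₂ ∷ xs) = cantorFrom (C₂ x₁ x₂) xs

-- Q(x₁,…,x_m, x_{m+1}) = e · C_{m+1}(x₁,…,x_m, P(x₁,…,x_m)² · x_{m+1}),
-- evaluated on nonnegative integers (where P² · x_{m+1} ≥ 0 is a natural).
Q : {k : ℕ} → ℕ → Poly (suc k) → Vec ℕ (suc k) → ℕ → ℕ
Q e P xs y = e * Cantor (xs ∷ʳ (∣ v ℤ.* v ∣ * y))
  where v = eval P (map +_ xs)

-- P(a, x₂, …, x_m) = 0 has a solution in nonnegative integers (m = suc k).
HasSol : {k : ℕ} → Poly (suc k) → ℕ → Set
HasSol {k} P a = Σ (Vec ℕ k) λ xs → eval P (map +_ (a ∷ xs)) ≡ + 0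

-- No algorithm (= Agda function) decides HasSol P a for positive a.
Undecidable : {k : ℕ} → Poly (suc k) → Set
Undecidable P =
  ¬ (Σ (ℕ → Bool) λ d → ∀ a → 1 ≤ a → ((d a ≡ true) ⇔ HasSol P a))

module Submission where

-- The reduction rests on one fact: the Cantor polynomials are injective.
-- Writing T(s) = s(s+1)/2 for the s-th triangular number, the pairing
-- C₂(x,y) = T(x+y) + y places (x,y) on the diagonal s = x+y at offset
-- y ≤ s; since T(s) + s < T(s+1), distinct diagonals occupy disjoint
-- intervals, so C₂(x,y) determines s, then y, then x.  Injectivity of C₂
-- propagates along the left-nested iteration to every C_k.
--
-- For Q = e · C_{m+1}(x, P(x)²·y) with e ≥ 1 this gives: Q(x,y) = Q(x',y')
-- forces x = x' and P(x)²·y = P(x)²·y'.  Hence a collision with (x,y) ≠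
-- (x',y') must have y ≠ y' and therefore P(x) = 0; conversely, at a root x
-- of P the value Q(x,y) does not depend on y, so (x,0) and (x,1) collide.

open import Defs
open import Data.Nat using (ℕ; zero; suc; _≤_; _<_; _+_; _*_; _/_; z≤n; s≤s; NonZero; >-nonZero)
open import Data.Nat.Properties
open import Data.Nat.DivMod using (m*n/n≡m)
open import Data.Nat.Tactic.RingSolver using (solve-∀)
open import Data.Integer as ℤ using (+_; ∣_∣)
open import Data.Integer.Properties using (∣i∣≡0⇒i≡0; i*j≡0⇒i≡0∨j≡0)
open import Data.Vec using (Vec; []; _∷_; _∷ʳ_; map)
open import Data.Vec.Properties using (∷ʳ-injective)
open import Data.Product using (∃-syntax; _×_; _,_)
open import Data.Sum using (_⊎_; inj₁; inj₂)
open import Data.Empty using (⊥-elim)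
open import Relation.Binary.PropositionalEquality
open import Relation.Binary.Definitions using (tri<; tri≈; tri>)
open import Relation.Nullary using (¬_; contradiction)
open import Function.Bundles using (_⇔_; mk⇔)

tri : ℕ → ℕ
tri zero    = 0
tri (suc s) = suc s + tri s

-- The closed form s(s+1) = 2·tri s, which removes the division from C₂.
s*[1+s]≡tri*2 : ∀ s → s * suc s ≡ tri s * 2
s*[1+s]≡tri*2 zero    = refl
s*[1+s]≡tri*2 (suc s) = begin
  suc s * suc (suc s)    ≡⟨ expand s ⟩
  s * suc s + suc s * 2  ≡⟨ cong (_+ suc s * 2) (s*[1+s]≡tri*2 s) ⟩
  tri s * 2 + suc s * 2  ≡⟨ sym (*-distribʳ-+ 2 (tri s) (suc s)) ⟩
  (tri s + suc s) * 2    ≡⟨ cong (_* 2) (+-comm (tri s) (suc s)) ⟩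
  tri (suc s) * 2        ∎
  where
  open ≡-Reasoning
  expand : ∀ n → suc n * suc (suc n) ≡ n * suc n + suc n * 2
  expand = solve-∀

C₂≡tri+ : ∀ x y → C₂ x y ≡ tri (x + y) + y
C₂≡tri+ x y = cong (_+ y) (begin
  (x + y) * (x + y + 1) / 2  ≡⟨ cong (λ t → (x + y) * t / 2) (+-comm (x + y) 1) ⟩
  (x + y) * suc (x + y) / 2  ≡⟨ cong (_/ 2) (s*[1+s]≡tri*2 (x + y)) ⟩
  tri (x + y) * 2 / 2        ≡⟨ m*n/n≡m (tri (x + y)) 2 ⟩
  tri (x + y)                ∎)
  where open ≡-Reasoning

tri-mono-≤ : ∀ {s s'} → s ≤ s' → tri s ≤ tri s'
tri-mono-≤ {zero}              _         = z≤n
tri-mono-≤ {suc s} {suc s'} (s≤s s≤s') = +-mono-≤ (s≤s s≤s') (tri-mono-≤ s≤s')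

diagonal-before : ∀ {s s' y} → s < s' → y ≤ s → tri s + y < tri s'
diagonal-before {s} {suc s'} {y} (s≤s s≤s') y≤s = begin-strict
  tri s + y     ≤⟨ +-monoʳ-≤ (tri s) y≤s ⟩
  tri s + s     ≤⟨ +-mono-≤ (tri-mono-≤ s≤s') s≤s' ⟩
  tri s' + s'   <⟨ n<1+n _ ⟩
  suc (tri s' + s') ≡⟨ cong suc (+-comm (tri s') s') ⟩
  tri (suc s')  ∎
  where open ≤-Reasoning

diagonal-unique : ∀ {s s' y y'} → y ≤ s → y' ≤ s' →
  tri s + y ≡ tri s' + y' → s ≡ s'
diagonal-unique {s} {s'} {y} {y'} y≤s y'≤s' eq with <-cmp s s'
... | tri< s<s' _ _ = contradiction eq (<⇒≢ (<-≤-trans (diagonal-before s<s' y≤s) (m≤m+n _ y')))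
... | tri≈ _ s≡s' _ = s≡s'
... | tri> _ _ s>s' = contradiction eq (>⇒≢ (<-≤-trans (diagonal-before s>s' y'≤s') (m≤m+n _ y)))

C₂-injective : ∀ {x y x' y'} → C₂ x y ≡ C₂ x' y' → x ≡ x' × y ≡ y'
C₂-injective {x} {y} {x'} {y'} eq = x≡x' , y≡y'
  where
  onDiagonals : tri (x + y) + y ≡ tri (x' + y') + y'
  onDiagonals = trans (sym (C₂≡tri+ x y)) (trans eq (C₂≡tri+ x' y'))
  sameDiagonal : x + y ≡ x' + y'
  sameDiagonal = diagonal-unique (m≤n+m y x) (m≤n+m y' x') onDiagonals
  y≡y' : y ≡ y'
  y≡y' = +-cancelˡ-≡ (tri (x + y)) y y'
           (trans onDiagonals (cong (λ s → tri s + y') (sym sameDiagonal)))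
  x≡x' : x ≡ x'
  x≡x' = +-cancelʳ-≡ y x x' (trans sameDiagonal (cong (λ t → x' + t) (sym y≡y')))

cantorFrom-injective : ∀ {j c c'} (ys ys' : Vec ℕ j) →
  cantorFrom c ys ≡ cantorFrom c' ys' → c ≡ c' × ys ≡ ys'
cantorFrom-injective []       []         eq = eq , refl
cantorFrom-injective {c = c} {c'} (y ∷ ys) (y' ∷ ys') eq
  with cantorFrom-injective ys ys' eq
... | pairs≡ , refl with C₂-injective {c} {y} {c'} {y'} pairs≡
...   | refl , refl = refl , refl

Cantor-injective : ∀ {j} (xs xs' : Vec ℕ (suc (suc j))) →
  Cantor xs ≡ Cantor xs' → xs ≡ xs'
Cantor-injective (x₁ ∷ x₂ ∷ xs) (x₁' ∷ x₂' ∷ xs') eq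
  with cantorFrom-injective xs xs' eq
... | pairs≡ , refl with C₂-injective {x₁} {x₂} {x₁'} {x₂'} pairs≡
...   | refl , refl = refl

square≡0⇒≡0 : ∀ v → ∣ v ℤ.* v ∣ ≡ 0 → v ≡ + 0
square≡0⇒≡0 v sq≡0 with i*j≡0⇒i≡0∨j≡0 v (∣i∣≡0⇒i≡0 sq≡0)
... | inj₁ v≡0 = v≡0
... | inj₂ v≡0 = v≡0

*-cancelˡ-or-zero : ∀ n {b c} → n * b ≡ n * c → n ≡ 0 ⊎ b ≡ c
*-cancelˡ-or-zero zero    _  = inj₁ refl
*-cancelˡ-or-zero (suc n) eq = inj₂ (*-cancelˡ-≡ _ _ (suc n) eq)

weight : ∀ {k} → Poly (suc k) → Vec ℕ (suc k) → ℕ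
weight P xs = ∣ v ℤ.* v ∣
  where v = eval P (map +_ xs)

Q-at-root : ∀ {k} e (P : Poly (suc k)) xs → eval P (map +_ xs) ≡ + 0 →
  ∀ y y' → Q e P xs y ≡ Q e P xs y'
Q-at-root e P xs root y y' rewrite root = refl

Q-collision : ∀ {k} e .{{_ : NonZero e}} (P : Poly (suc k)) xs xs' {y y'} →
  Q e P xs y ≡ Q e P xs' y' →
  xs ≡ xs' × weight P xs * y ≡ weight P xs' * y'
Q-collision e P xs xs' eq =
  ∷ʳ-injective xs xs' (Cantor-injective _ _ (*-cancelˡ-≡ _ _ e eq))

lemma7 : (k : ℕ) → 1 ≤ k → (P : Poly (suc k)) → Undecidable P →
    (e : ℕ) → 1 ≤ e → (a : ℕ) → 1 ≤ a →
    HasSol P a ⇔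
    (∃[ bs ] ∃[ b ] ∃[ cs ] ∃[ c ]
    (Q e P (a ∷ bs) b ≡ Q e P (a ∷ cs) c × ¬ ((bs , b) ≡ (cs , c))))
lemma7 k _ P _ e 1≤e a _ = mk⇔ root⇒collision collision⇒root
  where
  root⇒collision : HasSol P a →
    ∃[ bs ] ∃[ b ] ∃[ cs ] ∃[ c ]
      (Q e P (a ∷ bs) b ≡ Q e P (a ∷ cs) c × ¬ ((bs , b) ≡ (cs , c)))
  root⇒collision (xs , root) =
    xs , 0 , xs , 1 , Q-at-root e P (a ∷ xs) root 0 1 , λ ()

  collision⇒root :
    (∃[ bs ] ∃[ b ] ∃[ cs ] ∃[ c ]
      (Q e P (a ∷ bs) b ≡ Q e P (a ∷ cs) c × ¬ ((bs , b) ≡ (cs , c)))) →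
    HasSol P a
  collision⇒root (bs , b , cs , c , eq , distinct)
    with Q-collision e {{>-nonZero 1≤e}} P (a ∷ bs) (a ∷ cs) eq
  ... | refl , weighted≡ with *-cancelˡ-or-zero (weight P (a ∷ bs)) weighted≡
  ...   | inj₁ weight≡0 = bs , square≡0⇒≡0 _ weight≡0
  ...   | inj₂ refl     = ⊥-elim (distinct refl)
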